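{- For every request sequence $\sigma$ and every algorithm $\textsc{Alg}$ (online or offline) serving $\sigma$ on a self-adjusting complete binary tree, $\mathrm{cost}(\textsc{Alg}(\sigma)) \ge WS(\sigma)/4$.
   Context: Self-adjusting complete tree model: a set $V$ of $n$ items is stored in a complete binary tree of $n$ servers, one item per server. Server depths are fixed, the root has depth $0$, and the depth of an item at a given time is the depth of the server hosting it. A request sequence $\sigma=(\sigma^{(1)},\sigma^{(2)},\dots,\sigma^{(m)})$ of items is served; all requests originate at the root. Serving request $\sigma^{(t)}$ incurs an access cost equal to the current depth of $\sigma^{(t)}$. The algorithm may reconfigure the tree by swaps, a swap exchanging the items hosted at a server and at its parent, at cost $1$ per swap (adjustment cost). The cost $\mathrm{cost}(\textsc{Alg}(\sigma))$ is the total access cost plus the total adjustment cost. The working set of an item $v$ at time $t$ is the set of distinct items requested since the last request of $v$ before time $t$, including $v$; the rank $v.\mathrm{rank}^{(t)}$ is the size of this working set. The working set bound is $WS(\sigma)=\sum_{t=1}^{m}\log\big(\sigma^{(t)}.\mathrm{rank}^{(t)}\big)$, with $\log$ to base $2$. -}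

module Defs where

open import Data.Nat using (ℕ; zero; suc; _+_; _*_; _∸_; _^_; _≤_; ⌊_/2⌋)
open import Data.Nat.Logarithm using (⌊log₂_⌋)
open import Data.Fin using (Fin; toℕ; _≟_)
open import Data.List using (List; []; _∷_; length; deduplicate)
open import Data.Nat.ListAction using (product)
open import Relation.Nullary using (yes; no)
open import Relation.Binary.PropositionalEquality using (_≡_)

-- Servers of the complete binary tree with n servers are Fin n, laid out in
-- heap (BFS) order: server i (0-based) has 1-based heap index i+1, its parent
-- is the server with heap index ⌊(i+1)/2⌋, i.e. 0-based index ⌊(i-1)/2⌋.  Items are also Fin n.

depth : ∀ {n} → Fin n → ℕ
depth s = ⌊log₂ (suc (toℕ s)) ⌋

record Edge (n : ℕ) : Set where
  field
    child    : Fin n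
    parent   : Fin n
    nonRoot  : 1 ≤ toℕ child
    isParent : toℕ parent ≡ ⌊ toℕ child ∸ 1 /2⌋

-- A configuration maps each item to the server hosting it.
Config : ℕ → Set
Config n = Fin n → Fin n

swap : ∀ {n} → Edge n → Config n → Config n
swap e pos v with pos v ≟ Edge.child e
... | yes _ = Edge.parent e
... | no _ with pos v ≟ Edge.parent e
...   | yes _ = Edge.child e
...   | no _ = pos v

swaps : ∀ {n} → List (Edge n) → Config n → Config n
swaps [] pos = pos
swaps (e ∷ es) pos = swaps es (swap e pos)

-- An execution step: a request together with the swaps the algorithm
-- performs (after the previous request) before serving it.
-- cost = adjustment cost (number of swaps) + access cost (depth of the
-- requested item at serving time).
cost : ∀ {n} → Config n → List (Fin n) → List (List (Edge n)) → ℕ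
cost pos (r ∷ rs) (es ∷ ess) =
  length es + depth (swaps es pos r) + cost (swaps es pos) rs ess
cost pos _ _ = 0

-- items requested (most recent first) strictly after the last request of v
since : ∀ {n} → Fin n → List (Fin n) → List (Fin n)
since v [] = []
since v (x ∷ xs) with x ≟ v
... | yes _ = []
... | no _ = x ∷ since v xs

rank : ∀ {n} → Fin n → List (Fin n) → ℕ
rank v hist = length (deduplicate _≟_ (v ∷ since v hist))

ranksFrom : ∀ {n} → List (Fin n) → List (Fin n) → List ℕ
ranksFrom hist [] = []
ranksFrom hist (x ∷ xs) = rank x hist ∷ ranksFrom (x ∷ hist) xs

ranks : ∀ {n} → List (Fin n) → List ℕ
ranks σ = ranksFrom [] σ

-- 2^(WS(σ)) = ∏_t rank^(t), an exact natural number
twoToWS : ∀ {n} → List (Fin n) → ℕ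
twoToWS σ = product (ranks σ)

-- Fix a level j and let S be the set of servers of depth at most j; it has at most
-- 2^(j+1) - 1 elements.  Charge level j one unit for every swap across the boundary of S
-- and one unit for every access to an item outside S.  A child is one level below its
-- parent, so a swap is charged at exactly one level, and an access at depth d at d levels:
-- the level costs add up to at most the cost.
--
-- For a single set S of at most K servers and a cap M, give every item x hosted in S the
-- credit min(M, number of distinct items currently outside S requested since the last
-- request of x).  A request to an item outside S raises every credit by at most one, and a
-- swap across the boundary moves one item into S (new credit at most M) and one out (raising
-- every other credit by at most one); either way the total credit grows by at most M + K.
-- A request to an item in S of rank r spends its credit, which is at least min(M, r - K)
-- because at most K items of its working set fit into S.  Hence
-- Σ_t min(M, r_t - K) ≤ (M + K) · cost_S.
--
-- Level 0 with M = 3, K = 1 and level j ≥ 1 with M = K = 2^(j+1) then bound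
-- Σ_t (min(3, r_t - 1) + #{j ≥ 1 : 2^(j+2) ≤ r_t}) by 4 · cost, and 2 raised to this
-- exponent is at least r_t.

module Submission where

open import Defs
open import Data.Bool using (Bool; true; false; not; T; _xor_; if_then_else_)
open import Data.Fin using (Fin; toℕ; _≟_)
open import Data.Fin.Permutation.Components using (transpose; transpose-inverse)
open import Data.Fin.Properties using (toℕ-injective)
open import Data.List using (List; []; _∷_; [_]; _++_; length; map; filter; filterᵇ; allFin; upTo; downFrom; deduplicate)
open import Data.List.Membership.Propositional using (_∈_)
open import Data.List.Membership.Propositional.Properties
  using (∈-∃++; ∈-++⁻; ∈-++⁺ˡ; ∈-++⁺ʳ; ∈-map⁻; ∈-filter⁻; ∈-filter⁺; ∈-allFin; ∈-upTo⁺)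
open import Data.List.Properties using (length-map; length-++-sucʳ; length-upTo; length-tabulate; map-cong)
open import Data.List.Relation.Binary.Subset.Propositional using (_⊆_)
open import Data.List.Relation.Unary.All as All using (All; []; _∷_)
open import Data.List.Relation.Unary.Any using (here; there)
open import Data.List.Relation.Unary.Unique.Propositional using (Unique; []; _∷_)
open import Data.List.Relation.Unary.Unique.Propositional.Properties using (map⁺; filter⁺; allFin⁺; downFrom⁺)
import Data.List.Relation.Unary.Unique.DecPropositional.Properties as UniqueDec
open import Data.Nat using (ℕ; zero; suc; _+_; _*_; _∸_; _^_; _⊓_; _≤_; _<_; _≤ᵇ_; _≤?_; z≤n; s≤s; ⌊_/2⌋; NonZero)
open import Data.Nat.ListAction using (sum; product)
open import Data.Nat.Logarithm using (⌊log₂_⌋; ⌊log₂⌋-mono-≤; ⌊log₂[2^n]⌋≡n; ⌊log₂⌊n/2⌋⌋≡⌊log₂n⌋∸1)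
open import Data.Nat.Properties hiding (_≟_)
open import Data.Nat.Tactic.RingSolver using (solve-∀)
open import Algebra.Properties.CommutativeSemigroup +-commutativeSemigroup using (interchange; xy∙z≈xz∙y)
open import Data.Product using (_×_; _,_)
open import Data.Sum using (_⊎_; inj₁; inj₂)
open import Function using (_∘_; id)
open import Function.Definitions using (Injective)
open import Relation.Binary.PropositionalEquality using (_≡_; refl; sym; trans; cong; cong₂; subst; module ≡-Reasoning)
open import Relation.Nullary using (yes; no; ¬_; ¬?)
open import Relation.Nullary.Decidable using (T?; does; ⌊_⌋; toWitness; fromWitness)
open import Relation.Nullary.Negation using (contradiction)
open import Relation.Unary using (Decidable)

private variable
  A B : Set
  x y : A
  xs ys : List A
  n : ℕ

unique-⊆⇒length≤ : Unique xs → xs ⊆ ys → length xs ≤ length ys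
unique-⊆⇒length≤ [] _ = z≤n
unique-⊆⇒length≤ {xs = x ∷ xs} (x∉xs ∷ u) x∷xs⊆ys
  with ys₁ , ys₂ , refl ← ∈-∃++ (x∷xs⊆ys (here refl)) =
  ≤-trans (s≤s (unique-⊆⇒length≤ u xs⊆ys₁++ys₂)) (≤-reflexive (sym (length-++-sucʳ ys₁ x ys₂)))
  where
  xs⊆ys₁++ys₂ : xs ⊆ ys₁ ++ ys₂
  xs⊆ys₁++ys₂ {z} z∈xs with ∈-++⁻ ys₁ (x∷xs⊆ys (there z∈xs))
  ... | inj₁ z∈ys₁ = ∈-++⁺ˡ z∈ys₁
  ... | inj₂ (here refl) = contradiction refl (All.lookup x∉xs z∈xs)
  ... | inj₂ (there z∈ys₂) = ∈-++⁺ʳ ys₁ z∈ys₂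

sum-map-mono : ∀ {f g : A → ℕ} → (∀ x → f x ≤ g x) → ∀ xs → sum (map f xs) ≤ sum (map g xs)
sum-map-mono f≤g [] = z≤n
sum-map-mono f≤g (x ∷ xs) = +-mono-≤ (f≤g x) (sum-map-mono f≤g xs)

sum-map-+ : ∀ (f g : A → ℕ) xs → sum (map (λ x → f x + g x) xs) ≡ sum (map f xs) + sum (map g xs)
sum-map-+ f g [] = refl
sum-map-+ f g (x ∷ xs) = begin
  f x + g x + sum (map (λ x → f x + g x) xs)    ≡⟨ cong (f x + g x +_) (sum-map-+ f g xs) ⟩
  f x + g x + (sum (map f xs) + sum (map g xs)) ≡⟨ interchange (f x) (g x) _ _ ⟩
  f x + sum (map f xs) + (g x + sum (map g xs)) ∎
  where open ≡-Reasoning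

sum-map-*ˡ : ∀ m (f : A → ℕ) xs → sum (map (λ x → m * f x) xs) ≡ m * sum (map f xs)
sum-map-*ˡ m f [] = sym (*-zeroʳ m)
sum-map-*ˡ m f (x ∷ xs) = trans (cong (m * f x +_) (sum-map-*ˡ m f xs)) (sym (*-distribˡ-+ m (f x) _))

sum-map-zero : ∀ {f : A → ℕ} → (∀ x → f x ≡ 0) → ∀ xs → sum (map f xs) ≡ 0
sum-map-zero f≡0 [] = refl
sum-map-zero f≡0 (x ∷ xs) = cong₂ _+_ (f≡0 x) (sum-map-zero f≡0 xs)

sum-map-comm : ∀ (f : A → B → ℕ) xs ys →
               sum (map (λ x → sum (map (f x) ys)) xs) ≡ sum (map (λ y → sum (map (λ x → f x y) xs)) ys)
sum-map-comm f [] ys = sym (sum-map-zero (λ _ → refl) ys)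
sum-map-comm f (x ∷ xs) ys = begin
  sum (map (f x) ys) + sum (map (λ x → sum (map (f x) ys)) xs)
    ≡⟨ cong (sum (map (f x) ys) +_) (sum-map-comm f xs ys) ⟩
  sum (map (f x) ys) + sum (map (λ y → sum (map (λ x → f x y) xs)) ys)
    ≡⟨ sum-map-+ (f x) _ ys ⟨
  sum (map (λ y → f x y + sum (map (λ x → f x y) xs)) ys) ∎
  where open ≡-Reasoning

sum-map-mono-∈ : ∀ {f g : A → ℕ} {a} → y ∈ xs → f y + a ≤ g y → (∀ x → f x ≤ g x) →
                 sum (map f xs) + a ≤ sum (map g xs)
sum-map-mono-∈ {xs = x ∷ xs} {f = f} {g} {a} (here refl) fy+a≤gy f≤g = begin
  f x + sum (map f xs) + a ≡⟨ xy∙z≈xz∙y (f x) _ a ⟩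
  f x + a + sum (map f xs) ≤⟨ +-mono-≤ fy+a≤gy (sum-map-mono f≤g xs) ⟩
  g x + sum (map g xs)     ∎
  where open ≤-Reasoning
sum-map-mono-∈ {xs = x ∷ xs} {f = f} (there y∈xs) fy+a≤gy f≤g =
  ≤-trans (≤-reflexive (+-assoc (f x) _ _)) (+-mono-≤ (f≤g x) (sum-map-mono-∈ y∈xs fy+a≤gy f≤g))

product≤2^sum : ∀ {f : ℕ → ℕ} {rs} → All (λ r → r ≤ 2 ^ f r) rs → product rs ≤ 2 ^ sum (map f rs)
product≤2^sum [] = ≤-refl
product≤2^sum {f = f} {r ∷ rs} (r≤ ∷ rs≤) =
  ≤-trans (*-mono-≤ r≤ (product≤2^sum rs≤)) (≤-reflexive (sym (^-distribˡ-+-* 2 (f r) _)))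

⟦_⟧ : Bool → ℕ
⟦ true ⟧ = 1
⟦ false ⟧ = 0

T⇒⟦⟧≡1 : ∀ {b} → T b → ⟦ b ⟧ ≡ 1
T⇒⟦⟧≡1 {true} _ = refl

T⇒⟦not⟧≡0 : ∀ {b} → T b → ⟦ not b ⟧ ≡ 0
T⇒⟦not⟧≡0 {true} _ = refl

T-⊎-T-not : ∀ b → T b ⊎ T (not b)
T-⊎-T-not true = inj₁ _
T-⊎-T-not false = inj₂ _

T-not⇒¬T : ∀ {b} → T (not b) → ¬ T b
T-not⇒¬T {false} _ ()

⟦⟧-⊎ : ∀ a b c → (T a → T b ⊎ T c) → ⟦ a ⟧ ≤ ⟦ b ⟧ + ⟦ c ⟧
⟦⟧-⊎ false b c _ = z≤n
⟦⟧-⊎ true true c _ = s≤s z≤n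
⟦⟧-⊎ true false true _ = s≤s z≤n
⟦⟧-⊎ true false false a⇒b⊎c with a⇒b⊎c _
... | inj₁ ()
... | inj₂ ()

count : (A → Bool) → List A → ℕ
count p xs = sum (map (⟦_⟧ ∘ p) xs)

count-true : ∀ (xs : List A) → count (λ _ → true) xs ≡ length xs
count-true [] = refl
count-true (x ∷ xs) = cong suc (count-true xs)

count≡length-filterᵇ : ∀ (p : A → Bool) xs → count p xs ≡ length (filterᵇ p xs)
count≡length-filterᵇ p [] = refl
count≡length-filterᵇ p (x ∷ xs) with p x
... | true = cong suc (count≡length-filterᵇ p xs)
... | false = count≡length-filterᵇ p xs

count-⊎ : ∀ {p q r : A → Bool} → (∀ x → T (p x) → T (q x) ⊎ T (r x)) → ∀ xs →
          count p xs ≤ count q xs + count r xs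
count-⊎ {p = p} {q} {r} p⇒q⊎r xs = begin
  count p xs                              ≤⟨ sum-map-mono (λ x → ⟦⟧-⊎ (p x) (q x) (r x) (p⇒q⊎r x)) xs ⟩
  sum (map (λ x → ⟦ q x ⟧ + ⟦ r x ⟧) xs)  ≡⟨ sum-map-+ (⟦_⟧ ∘ q) (⟦_⟧ ∘ r) xs ⟩
  count q xs + count r xs                 ∎
  where open ≤-Reasoning

count-filter≤ : ∀ {P : A → Set} (P? : Decidable P) (p : A → Bool) xs → count p (filter P? xs) ≤ count p xs
count-filter≤ P? p [] = z≤n
count-filter≤ P? p (x ∷ xs) with does (P? x)
... | true = +-monoʳ-≤ ⟦ p x ⟧ (count-filter≤ P? p xs)
... | false = ≤-trans (count-filter≤ P? p xs) (m≤n+m _ ⟦ p x ⟧)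

injection⇒count≤length : ∀ {p : A → Bool} (f : A → B) → Injective _≡_ _≡_ f → Unique xs →
                         (∀ {x} → x ∈ xs → T (p x) → f x ∈ ys) → count p xs ≤ length ys
injection⇒count≤length {xs = xs} {ys} {p} f f-inj xs! image = begin
  count p xs                     ≡⟨ count≡length-filterᵇ p xs ⟩
  length (filterᵇ p xs)          ≡⟨ length-map f (filterᵇ p xs) ⟨
  length (map f (filterᵇ p xs))  ≤⟨ unique-⊆⇒length≤ (map⁺ f-inj (filter⁺ (T? ∘ p) xs!)) image⁺ ⟩
  length ys                      ∎
  where
  open ≤-Reasoning
  image⁺ : map f (filterᵇ p xs) ⊆ ys
  image⁺ y∈ with x , x∈ , refl ← ∈-map⁻ f y∈ =
    let x∈xs , px = ∈-filter⁻ (T? ∘ p) x∈ in image x∈xs px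

⊓-suc≤ : ∀ m n → m ⊓ suc n ≤ suc (m ⊓ n)
⊓-suc≤ zero n = z≤n
⊓-suc≤ (suc m) n = s≤s (⊓-monoˡ-≤ n (n≤1+n m))

n<2^n : ∀ n → n < 2 ^ n
n<2^n zero = s≤s z≤n
n<2^n (suc n) = ≤-<-trans (n<2^n n) (^-monoʳ-< 2 (s≤s (s≤s z≤n)) (n<1+n n))

2^k≤⇒k≤⌊log₂⌋ : ∀ {k m} → 2 ^ k ≤ m → k ≤ ⌊log₂ m ⌋
2^k≤⇒k≤⌊log₂⌋ {k} 2^k≤m = subst (_≤ _) (⌊log₂[2^n]⌋≡n k) (⌊log₂⌋-mono-≤ 2^k≤m)

≤ᵇ-xor-suc≤ᵇ⇒≡ : ∀ d j → T ((d ≤ᵇ j) xor (suc d ≤ᵇ j)) → j ≡ d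
≤ᵇ-xor-suc≤ᵇ⇒≡ zero zero _ = refl
≤ᵇ-xor-suc≤ᵇ⇒≡ zero (suc j) ()
≤ᵇ-xor-suc≤ᵇ⇒≡ (suc d) zero ()
≤ᵇ-xor-suc≤ᵇ⇒≡ (suc zero) (suc j) t = cong suc (≤ᵇ-xor-suc≤ᵇ⇒≡ zero j t)
≤ᵇ-xor-suc≤ᵇ⇒≡ (suc (suc d)) (suc j) t = cong suc (≤ᵇ-xor-suc≤ᵇ⇒≡ (suc d) j t)

-- Swaps and levels of the tree

transpose-cases : ∀ (i j k : Fin n) →
  (k ≡ i × transpose i j k ≡ j) ⊎ (k ≡ j × transpose i j k ≡ i) ⊎ transpose i j k ≡ k
transpose-cases i j k with k ≟ i
... | yes k≡i = inj₁ (k≡i , refl)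
... | no _ with k ≟ j
...   | yes k≡j = inj₂ (inj₁ (k≡j , refl))
...   | no _ = inj₂ (inj₂ refl)

swap≡transpose : ∀ (e : Edge n) pos v → swap e pos v ≡ transpose (Edge.child e) (Edge.parent e) (pos v)
swap≡transpose e pos v with pos v ≟ Edge.child e
... | yes _ = refl
... | no _ with pos v ≟ Edge.parent e
...   | yes _ = refl
...   | no _ = refl

swap-injective : ∀ (e : Edge n) {pos} → Injective _≡_ _≡_ pos → Injective _≡_ _≡_ (swap e pos)
swap-injective e {pos} pos-inj {x} {y} swap-x≡swap-y = pos-inj (begin
  pos x                                 ≡⟨ transpose-inverse parent child ⟨
  transpose parent child (τ (pos x))    ≡⟨ cong (transpose parent child) τx≡τy ⟩
  transpose parent child (τ (pos y))    ≡⟨ transpose-inverse parent child ⟩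
  pos y                                 ∎)
  where
  open Edge e
  open ≡-Reasoning
  τ = transpose child parent
  τx≡τy : τ (pos x) ≡ τ (pos y)
  τx≡τy = trans (sym (swap≡transpose e pos x)) (trans swap-x≡swap-y (swap≡transpose e pos y))

swaps-injective : ∀ (es : List (Edge n)) {pos} → Injective _≡_ _≡_ pos → Injective _≡_ _≡_ (swaps es pos)
swaps-injective [] pos-inj = pos-inj
swaps-injective (e ∷ es) pos-inj = swaps-injective es (swap-injective e pos-inj)

Exchanges : Fin n → Fin n → Config n → Config n → Set
Exchanges u v pos pos′ =
  ∀ z → (pos z ≡ u × pos′ z ≡ v) ⊎ (pos z ≡ v × pos′ z ≡ u) ⊎ pos′ z ≡ pos z

Exchanges-sym : ∀ {u v : Fin n} {pos pos′} → Exchanges u v pos pos′ → Exchanges v u pos pos′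
Exchanges-sym exch z with exch z
... | inj₁ at-u = inj₂ (inj₁ at-u)
... | inj₂ (inj₁ at-v) = inj₁ at-v
... | inj₂ (inj₂ fixed) = inj₂ (inj₂ fixed)

swap-exchanges : ∀ (e : Edge n) pos → Exchanges (Edge.child e) (Edge.parent e) pos (swap e pos)
swap-exchanges e pos z rewrite swap≡transpose e pos z = transpose-cases _ _ (pos z)

depth-child : (e : Edge n) → depth (Edge.child e) ≡ suc (depth (Edge.parent e))
depth-child e = begin
  depth child                        ≡⟨ suc-∸1 depth-child≥1 ⟨
  suc (⌊log₂ suc (toℕ child) ⌋ ∸ 1)  ≡⟨ cong suc (⌊log₂⌊n/2⌋⌋≡⌊log₂n⌋∸1 (suc (toℕ child))) ⟨
  suc ⌊log₂ ⌊ suc (toℕ child) /2⌋ ⌋  ≡⟨ cong (λ m → suc ⌊log₂ m ⌋) (trans (halve nonRoot) (cong suc (sym isParent))) ⟩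
  suc (depth parent)                 ∎
  where
  open Edge e
  open ≡-Reasoning
  suc-∸1 : ∀ {d} → 1 ≤ d → suc (d ∸ 1) ≡ d
  suc-∸1 (s≤s _) = refl
  depth-child≥1 : 1 ≤ depth child
  depth-child≥1 = subst (_≤ depth child) (⌊log₂[2^n]⌋≡n 1) (⌊log₂⌋-mono-≤ (s≤s nonRoot))
  halve : ∀ {c} → 1 ≤ c → ⌊ suc c /2⌋ ≡ suc ⌊ c ∸ 1 /2⌋
  halve (s≤s _) = refl

suc<2^suc-depth : ∀ (s : Fin n) → suc (toℕ s) < 2 ^ suc (depth s)
suc<2^suc-depth s = ≰⇒> (λ 2^≤ → n≮n _ (2^k≤⇒k≤⌊log₂⌋ 2^≤))

top : ℕ → Fin n → Bool
top j s = depth s ≤ᵇ j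

count-top≤ : ∀ j → count (top j) (allFin n) ≤ 2 ^ suc j ∸ 1
count-top≤ {n} j = begin
  count (top j) (allFin n)       ≤⟨ injection⇒count≤length toℕ toℕ-injective (allFin⁺ n) (λ {s} _ → ∈-upTo⁺ ∘ below s) ⟩
  length (upTo (2 ^ suc j ∸ 1))  ≡⟨ length-upTo _ ⟩
  2 ^ suc j ∸ 1                  ∎
  where
  open ≤-Reasoning
  below : ∀ s → T (top j s) → toℕ s < 2 ^ suc j ∸ 1
  below s t = m+n≤o⇒m≤o∸n (suc (toℕ s)) (≤-trans (≤-reflexive (+-comm (suc (toℕ s)) 1))
    (≤-trans (suc<2^suc-depth s) (^-monoʳ-≤ 2 (s≤s (≤ᵇ⇒≤ (depth s) j t)))))

crosses : (Fin n → Bool) → Edge n → Bool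
crosses S e = S (Edge.parent e) xor S (Edge.child e)

count-crossing-levels≤1 : ∀ (e : Edge n) L → count (λ j → crosses (top j) e) (downFrom L) ≤ 1
count-crossing-levels≤1 e L =
  injection⇒count≤length {ys = [ depth parent ]} id id (downFrom⁺ L) (λ {j} _ → here ∘ crossing-level j)
  where
  open Edge e
  crossing-level : ∀ j → T (crosses (top j) e) → j ≡ depth parent
  crossing-level j = ≤ᵇ-xor-suc≤ᵇ⇒≡ (depth parent) j ∘ subst (λ d → T ((depth parent ≤ᵇ j) xor (d ≤ᵇ j))) (depth-child e)

count-levels-below≤depth : ∀ (s : Fin n) L → count (λ j → not (top j s)) (downFrom L) ≤ depth s
count-levels-below≤depth s L = begin
  count (λ j → not (top j s)) (downFrom L)  ≤⟨ injection⇒count≤length id id (downFrom⁺ L) (λ {j} _ → ∈-upTo⁺ ∘ above j) ⟩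
  length (upTo (depth s))                   ≡⟨ length-upTo (depth s) ⟩
  depth s                                   ∎
  where
  open ≤-Reasoning
  above : ∀ j → T (not (top j s)) → j < depth s
  above j t = ≰⇒> (λ d≤j → T-not⇒¬T t (≤⇒≤ᵇ d≤j))

levelCost : (Fin n → Bool) → Config n → List (Fin n) → List (List (Edge n)) → ℕ
levelCost S pos (r ∷ rs) (es ∷ ess) =
  count (crosses S) es + ⟦ not (S (swaps es pos r)) ⟧ + levelCost S (swaps es pos) rs ess
levelCost S pos _ _ = 0

sum-crossings≤length : ∀ (es : List (Edge n)) L →
  sum (map (λ j → count (crosses (top j)) es) (downFrom L)) ≤ length es
sum-crossings≤length es L = begin
  sum (map (λ j → count (crosses (top j)) es) (downFrom L))
    ≡⟨ sum-map-comm (λ j e → ⟦ crosses (top j) e ⟧) (downFrom L) es ⟩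
  sum (map (λ e → count (λ j → crosses (top j) e) (downFrom L)) es)
    ≤⟨ sum-map-mono (λ e → count-crossing-levels≤1 e L) es ⟩
  count (λ _ → true) es
    ≡⟨ count-true es ⟩
  length es ∎
  where open ≤-Reasoning

levelCosts≤cost : ∀ L (pos : Config n) σ alg →
  sum (map (λ j → levelCost (top j) pos σ alg) (downFrom L)) ≤ cost pos σ alg
levelCosts≤cost L pos [] alg = ≤-reflexive (sum-map-zero (λ _ → refl) (downFrom L))
levelCosts≤cost L pos (r ∷ σ) [] = ≤-reflexive (sum-map-zero (λ _ → refl) (downFrom L))
levelCosts≤cost L pos (r ∷ σ) (es ∷ alg) = begin
  sum (map (λ j → crossings j + served j + rest j) (downFrom L))
    ≡⟨ sum-map-+ (λ j → crossings j + served j) rest (downFrom L) ⟩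
  sum (map (λ j → crossings j + served j) (downFrom L)) + sum (map rest (downFrom L))
    ≡⟨ cong (_+ sum (map rest (downFrom L))) (sum-map-+ crossings served (downFrom L)) ⟩
  sum (map crossings (downFrom L)) + sum (map served (downFrom L)) + sum (map rest (downFrom L))
    ≤⟨ +-mono-≤ (+-mono-≤ (sum-crossings≤length es L) (count-levels-below≤depth (pos′ r) L))
                (levelCosts≤cost L pos′ σ alg) ⟩
  length es + depth (pos′ r) + cost pos′ σ alg ∎
  where
  open ≤-Reasoning
  pos′ = swaps es pos
  crossings served rest : ℕ → ℕ
  crossings j = count (crosses (top j)) es
  served j = ⟦ not (top j (pos′ r)) ⟧
  rest j = levelCost (top j) pos′ σ alg

-- The potential argument at one level

since-self : ∀ (y : Fin n) hist → since y (y ∷ hist) ≡ []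
since-self y hist with y ≟ y
... | yes _ = refl
... | no y≢y = contradiction refl y≢y

module Potential {n} (S : Fin n → Bool) {K} (|S|≤K : count S (allFin n) ≤ K) (M : ℕ) where

  inside outside : Config n → Fin n → Bool
  inside pos x = S (pos x)
  outside pos x = not (S (pos x))

  outsideWS : Config n → List (Fin n) → Fin n → ℕ
  outsideWS pos hist x = count (outside pos) (deduplicate _≟_ (since x hist))

  credit : Config n → List (Fin n) → Fin n → ℕ
  credit pos hist x = if inside pos x then M ⊓ outsideWS pos hist x else 0

  potential : Config n → List (Fin n) → ℕ
  potential pos hist = sum (map (credit pos hist) (allFin n))

  potential-[] : ∀ pos → potential pos [] ≡ 0
  potential-[] pos = sum-map-zero credit-[] (allFin n)
    where
    credit-[] : ∀ x → credit pos [] x ≡ 0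
    credit-[] x with inside pos x
    ... | true = ⊓-zeroʳ M
    ... | false = refl

  count-inside : ∀ {pos : Config n} {xs} → Injective _≡_ _≡_ pos → Unique xs → count (inside pos) xs ≤ K
  count-inside {pos} {xs} pos-inj xs! = begin
    count (inside pos) xs          ≤⟨ injection⇒count≤length pos pos-inj xs! (λ _ → ∈-filter⁺ (T? ∘ S) (∈-allFin _)) ⟩
    length (filterᵇ S (allFin n))  ≡⟨ count≡length-filterᵇ S (allFin n) ⟨
    count S (allFin n)             ≤⟨ |S|≤K ⟩
    K                              ∎
    where open ≤-Reasoning

  count-at : ∀ {pos : Config n} {xs} (u : Fin n) → Injective _≡_ _≡_ pos → Unique xs →
             count (λ z → ⌊ pos z ≟ u ⌋) xs ≤ 1
  count-at u pos-inj xs! = injection⇒count≤length {ys = [ u ]} _ pos-inj xs! (λ _ → here ∘ toWitness)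

  outsideWS-self : ∀ pos (y : Fin n) hist → outsideWS pos (y ∷ hist) y ≡ 0
  outsideWS-self pos y hist = cong (count (outside pos) ∘ deduplicate _≟_) (since-self y hist)

  outsideWS-request : ∀ pos (y : Fin n) hist x →
                      outsideWS pos (y ∷ hist) x ≤ ⟦ outside pos y ⟧ + outsideWS pos hist x
  outsideWS-request pos y hist x with y ≟ x
  ... | yes refl = z≤n
  ... | no _ = +-monoʳ-≤ ⟦ outside pos y ⟧
                 (count-filter≤ (¬? ∘ (y ≟_)) (outside pos) (deduplicate _≟_ (since x hist)))

  rank≤ : ∀ {pos} → Injective _≡_ _≡_ pos → ∀ (y : Fin n) hist →
          rank y hist ≤ K + (⟦ outside pos y ⟧ + outsideWS pos hist y)
  rank≤ {pos} pos-inj y hist = begin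
    length ws                                    ≡⟨ count-true ws ⟨
    count (λ _ → true) ws                        ≤⟨ count-⊎ (λ z _ → T-⊎-T-not (inside pos z)) ws ⟩
    count (inside pos) ws + count (outside pos) ws
      ≤⟨ +-mono-≤ (count-inside pos-inj (UniqueDec.deduplicate-! _≟_ (y ∷ since y hist)))
                  (+-monoʳ-≤ ⟦ outside pos y ⟧
                     (count-filter≤ (¬? ∘ (y ≟_)) (outside pos) (deduplicate _≟_ (since y hist)))) ⟩
    K + (⟦ outside pos y ⟧ + outsideWS pos hist y) ∎
    where
    open ≤-Reasoning
    ws = deduplicate _≟_ (y ∷ since y hist)

  credit≤ : ∀ pos hist (x : Fin n) → credit pos hist x ≤ M ⊓ outsideWS pos hist x
  credit≤ pos hist x with inside pos x
  ... | true = ≤-refl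
  ... | false = z≤n

  credit-inside : ∀ pos hist (x : Fin n) → T (inside pos x) → credit pos hist x ≡ M ⊓ outsideWS pos hist x
  credit-inside pos hist x x-in with inside pos x
  ... | true = refl

  credit-outside : ∀ pos hist (x : Fin n) → ¬ T (inside pos x) → credit pos hist x ≡ 0
  credit-outside pos hist x x-out with inside pos x
  ... | true = contradiction _ x-out
  ... | false = refl

  credit-mono : ∀ pos hist hist′ (x : Fin n) → outsideWS pos hist′ x ≤ outsideWS pos hist x →
                credit pos hist′ x ≤ credit pos hist x
  credit-mono pos hist hist′ x N′≤N with inside pos x
  ... | true = ⊓-monoʳ-≤ M N′≤N
  ... | false = z≤n

  credit-step : ∀ pos pos′ hist hist′ (x : Fin n) → (T (inside pos′ x) → T (inside pos x)) →
                outsideWS pos′ hist′ x ≤ suc (outsideWS pos hist x) →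
                credit pos′ hist′ x ≤ credit pos hist x + ⟦ inside pos x ⟧
  credit-step pos pos′ hist hist′ x in′⇒in N′≤1+N with inside pos′ x | inside pos x
  ... | false | _ = z≤n
  ... | true | false = contradiction (in′⇒in _) λ ()
  ... | true | true = begin
    M ⊓ outsideWS pos′ hist′ x        ≤⟨ ⊓-monoʳ-≤ M N′≤1+N ⟩
    M ⊓ suc (outsideWS pos hist x)   ≤⟨ ⊓-suc≤ M _ ⟩
    suc (M ⊓ outsideWS pos hist x)   ≡⟨ +-comm 1 _ ⟩
    M ⊓ outsideWS pos hist x + 1     ∎
    where open ≤-Reasoning

  potential-step : ∀ pos pos′ hist hist′ (g : Fin n → ℕ) → Injective _≡_ _≡_ pos →
    (∀ x → credit pos′ hist′ x ≤ credit pos hist x + ⟦ inside pos x ⟧ + g x) →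
    potential pos′ hist′ ≤ potential pos hist + K + sum (map g (allFin n))
  potential-step pos pos′ hist hist′ g pos-inj credit′≤ = begin
    potential pos′ hist′
      ≤⟨ sum-map-mono credit′≤ (allFin n) ⟩
    sum (map (λ x → credit pos hist x + ⟦ inside pos x ⟧ + g x) (allFin n))
      ≡⟨ sum-map-+ (λ x → credit pos hist x + ⟦ inside pos x ⟧) g (allFin n) ⟩
    sum (map (λ x → credit pos hist x + ⟦ inside pos x ⟧) (allFin n)) + sum (map g (allFin n))
      ≡⟨ cong (_+ sum (map g (allFin n))) (sum-map-+ (credit pos hist) (⟦_⟧ ∘ inside pos) (allFin n)) ⟩
    potential pos hist + count (inside pos) (allFin n) + sum (map g (allFin n))
      ≤⟨ +-monoˡ-≤ _ (+-monoʳ-≤ (potential pos hist) (count-inside pos-inj (allFin⁺ n))) ⟩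
    potential pos hist + K + sum (map g (allFin n)) ∎
    where open ≤-Reasoning

  request-inside : ∀ {pos} → Injective _≡_ _≡_ pos → ∀ (y : Fin n) hist → T (inside pos y) →
    potential pos (y ∷ hist) + M ⊓ (rank y hist ∸ K) ≤ potential pos hist
  request-inside {pos} pos-inj y hist y-in =
    sum-map-mono-∈ (∈-allFin y) served-credit (λ x → credit-mono pos hist (y ∷ hist) x (N-request x))
    where
    N-request : ∀ x → outsideWS pos (y ∷ hist) x ≤ outsideWS pos hist x
    N-request x = subst (λ o → outsideWS pos (y ∷ hist) x ≤ o + outsideWS pos hist x)
                        (T⇒⟦not⟧≡0 y-in) (outsideWS-request pos y hist x)
    rank≤K+N : rank y hist ≤ K + outsideWS pos hist y
    rank≤K+N = subst (λ o → rank y hist ≤ K + (o + outsideWS pos hist y))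
                     (T⇒⟦not⟧≡0 y-in) (rank≤ pos-inj y hist)
    served-credit : credit pos (y ∷ hist) y + M ⊓ (rank y hist ∸ K) ≤ credit pos hist y
    served-credit = begin
      credit pos (y ∷ hist) y + M ⊓ (rank y hist ∸ K)
        ≤⟨ +-monoˡ-≤ _ (credit≤ pos (y ∷ hist) y) ⟩
      M ⊓ outsideWS pos (y ∷ hist) y + M ⊓ (rank y hist ∸ K)
        ≡⟨ cong (λ N → M ⊓ N + M ⊓ (rank y hist ∸ K)) (outsideWS-self pos y hist) ⟩
      M ⊓ 0 + M ⊓ (rank y hist ∸ K)
        ≡⟨ cong (_+ M ⊓ (rank y hist ∸ K)) (⊓-zeroʳ M) ⟩
      M ⊓ (rank y hist ∸ K)
        ≤⟨ ⊓-monoʳ-≤ M (m≤n+o⇒m∸n≤o (rank y hist) K rank≤K+N) ⟩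
      M ⊓ outsideWS pos hist y
        ≡⟨ credit-inside pos hist y y-in ⟨
      credit pos hist y ∎
      where open ≤-Reasoning

  request-outside : ∀ {pos} → Injective _≡_ _≡_ pos → ∀ (y : Fin n) hist → T (outside pos y) →
    potential pos (y ∷ hist) + M ⊓ (rank y hist ∸ K) ≤ potential pos hist + (M + K)
  request-outside {pos} pos-inj y hist y-out = begin
    potential pos (y ∷ hist) + M ⊓ (rank y hist ∸ K)
      ≤⟨ +-mono-≤ (potential-step pos pos hist (y ∷ hist) (λ _ → 0) pos-inj credit-request) (m⊓n≤m M _) ⟩
    potential pos hist + K + sum (map (λ _ → 0) (allFin n)) + M
      ≡⟨ cong (λ z → potential pos hist + K + z + M) (sum-map-zero (λ _ → refl) (allFin n)) ⟩
    potential pos hist + K + 0 + M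
      ≡⟨ regroup (potential pos hist) K M ⟩
    potential pos hist + (M + K) ∎
    where
    open ≤-Reasoning
    regroup : ∀ a b c → a + b + 0 + c ≡ a + (c + b)
    regroup = solve-∀
    N-request : ∀ x → outsideWS pos (y ∷ hist) x ≤ suc (outsideWS pos hist x)
    N-request x = subst (λ o → outsideWS pos (y ∷ hist) x ≤ o + outsideWS pos hist x)
                        (T⇒⟦⟧≡1 y-out) (outsideWS-request pos y hist x)
    credit-request : ∀ x → credit pos (y ∷ hist) x ≤ credit pos hist x + ⟦ inside pos x ⟧ + 0
    credit-request x = ≤-trans (credit-step pos pos hist (y ∷ hist) x (λ x-in → x-in) (N-request x)) (m≤m+n _ 0)

  request-step : ∀ {pos} → Injective _≡_ _≡_ pos → ∀ (y : Fin n) hist →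
    potential pos (y ∷ hist) + M ⊓ (rank y hist ∸ K) ≤ potential pos hist + (M + K) * ⟦ outside pos y ⟧
  request-step {pos} pos-inj y hist with T-⊎-T-not (inside pos y)
  ... | inj₁ y-in = ≤-trans (request-inside pos-inj y hist y-in) (m≤m+n _ _)
  ... | inj₂ y-out = begin
    potential pos (y ∷ hist) + M ⊓ (rank y hist ∸ K)
      ≤⟨ request-outside pos-inj y hist y-out ⟩
    potential pos hist + (M + K)
      ≡⟨ cong (potential pos hist +_) (*-identityʳ (M + K)) ⟨
    potential pos hist + (M + K) * 1
      ≡⟨ cong (λ o → potential pos hist + (M + K) * o) (T⇒⟦⟧≡1 y-out) ⟨
    potential pos hist + (M + K) * ⟦ outside pos y ⟧ ∎
    where open ≤-Reasoning

  exchange-leaving : ∀ {u v : Fin n} {pos pos′} → Exchanges u v pos pos′ → T (not (S v)) →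
                     ∀ z → T (outside pos′ z) → T (outside pos z) ⊎ T ⌊ pos z ≟ u ⌋
  exchange-leaving exch v-out z z-out′ with exch z
  ... | inj₁ (at-u , _) = inj₂ (fromWitness at-u)
  ... | inj₂ (inj₁ (at-v , _)) = inj₁ (subst (T ∘ not ∘ S) (sym at-v) v-out)
  ... | inj₂ (inj₂ fixed) = inj₁ (subst (T ∘ not ∘ S) fixed z-out′)

  exchange-entering : ∀ {u v : Fin n} {pos pos′} → Exchanges u v pos pos′ → T (S u) →
                      ∀ z → T (inside pos′ z) → T (inside pos z) ⊎ pos z ≡ v
  exchange-entering exch u-in z z-in′ with exch z
  ... | inj₁ (at-u , _) = inj₁ (subst (T ∘ S) (sym at-u) u-in)
  ... | inj₂ (inj₁ (at-v , _)) = inj₂ at-v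
  ... | inj₂ (inj₂ fixed) = inj₁ (subst (T ∘ S) fixed z-in′)

  outsideWS-exchange : ∀ {u v : Fin n} {pos pos′} → Injective _≡_ _≡_ pos → Exchanges u v pos pos′ →
                       T (not (S v)) → ∀ hist x → outsideWS pos′ hist x ≤ suc (outsideWS pos hist x)
  outsideWS-exchange {u} {pos = pos} {pos′} pos-inj exch v-out hist x = begin
    outsideWS pos′ hist x
      ≤⟨ count-⊎ (exchange-leaving exch v-out) ws ⟩
    outsideWS pos hist x + count (λ z → ⌊ pos z ≟ u ⌋) ws
      ≤⟨ +-monoʳ-≤ _ (count-at u pos-inj (UniqueDec.deduplicate-! _≟_ (since x hist))) ⟩
    outsideWS pos hist x + 1
      ≡⟨ +-comm _ 1 ⟩
    suc (outsideWS pos hist x) ∎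
    where
    open ≤-Reasoning
    ws = deduplicate _≟_ (since x hist)

  exchange-step : ∀ {u v : Fin n} {pos pos′} → Injective _≡_ _≡_ pos → Exchanges u v pos pos′ →
    T (S u) → T (not (S v)) → ∀ hist → potential pos′ hist ≤ potential pos hist + (M + K) * 1
  exchange-step {u} {v} {pos} {pos′} pos-inj exch u-in v-out hist = begin
    potential pos′ hist
      ≤⟨ potential-step pos pos′ hist hist (λ x → M * ⟦ ⌊ pos x ≟ v ⌋ ⟧) pos-inj credit-exchange ⟩
    potential pos hist + K + sum (map (λ x → M * ⟦ ⌊ pos x ≟ v ⌋ ⟧) (allFin n))
      ≡⟨ cong (potential pos hist + K +_) (sum-map-*ˡ M (λ x → ⟦ ⌊ pos x ≟ v ⌋ ⟧) (allFin n)) ⟩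
    potential pos hist + K + M * count (λ x → ⌊ pos x ≟ v ⌋) (allFin n)
      ≤⟨ +-monoʳ-≤ (potential pos hist + K) (*-monoʳ-≤ M (count-at v pos-inj (allFin⁺ n))) ⟩
    potential pos hist + K + M * 1
      ≡⟨ regroup (potential pos hist) K M ⟩
    potential pos hist + (M + K) * 1 ∎
    where
    open ≤-Reasoning
    regroup : ∀ a b c → a + b + c * 1 ≡ a + (c + b) * 1
    regroup = solve-∀
    credit-exchange : ∀ x → credit pos′ hist x ≤
                            credit pos hist x + ⟦ inside pos x ⟧ + M * ⟦ ⌊ pos x ≟ v ⌋ ⟧
    credit-exchange x with T? (inside pos′ x)
    ... | no x-out′ = ≤-trans (≤-reflexive (credit-outside pos′ hist x x-out′)) z≤n
    ... | yes x-in′ with exchange-entering exch u-in x x-in′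
    ...   | inj₁ x-in = ≤-trans (credit-step pos pos′ hist hist x (λ _ → x-in)
                                  (outsideWS-exchange pos-inj exch v-out hist x)) (m≤m+n _ _)
    ...   | inj₂ at-v = begin
      credit pos′ hist x                 ≤⟨ credit≤ pos′ hist x ⟩
      M ⊓ outsideWS pos′ hist x          ≤⟨ m⊓n≤m M _ ⟩
      M                                  ≡⟨ *-identityʳ M ⟨
      M * 1                              ≡⟨ cong (M *_) (T⇒⟦⟧≡1 (fromWitness at-v)) ⟨
      M * ⟦ ⌊ pos x ≟ v ⌋ ⟧              ≤⟨ m≤n+m _ _ ⟩
      credit pos hist x + ⟦ inside pos x ⟧ + M * ⟦ ⌊ pos x ≟ v ⌋ ⟧ ∎

  potential-cong : ∀ {pos pos′} → (∀ x → inside pos′ x ≡ inside pos x) →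
                   ∀ hist → potential pos′ hist ≡ potential pos hist
  potential-cong {pos} {pos′} same hist = cong sum (map-cong credit-cong (allFin n))
    where
    credit-cong : ∀ x → credit pos′ hist x ≡ credit pos hist x
    credit-cong x = cong₂ (λ b N → if b then M ⊓ N else 0) (same x)
      (cong sum (map-cong (λ z → cong (⟦_⟧ ∘ not) (same z)) (deduplicate _≟_ (since x hist))))

  exchange-same-side : ∀ {u v : Fin n} {pos pos′} → Exchanges u v pos pos′ → S u ≡ S v →
                       ∀ x → inside pos′ x ≡ inside pos x
  exchange-same-side exch Su≡Sv x with exch x
  ... | inj₁ (at-u , to-v) = trans (cong S to-v) (trans (sym Su≡Sv) (cong S (sym at-u)))
  ... | inj₂ (inj₁ (at-v , to-u)) = trans (cong S to-u) (trans Su≡Sv (cong S (sym at-v)))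
  ... | inj₂ (inj₂ fixed) = cong S fixed

  swap-same-side : ∀ {pos} (e : Edge n) → S (Edge.child e) ≡ S (Edge.parent e) →
                   ∀ hist → potential (swap e pos) hist ≡ potential pos hist
  swap-same-side {pos} e same = potential-cong (exchange-same-side (swap-exchanges e pos) same)

  swap-step : ∀ {pos} → Injective _≡_ _≡_ pos → ∀ (e : Edge n) hist →
    potential (swap e pos) hist ≤ potential pos hist + (M + K) * ⟦ crosses S e ⟧
  swap-step {pos} pos-inj e hist with S (Edge.parent e) in ep | S (Edge.child e) in ec
  ... | true | false = exchange-step pos-inj (Exchanges-sym (swap-exchanges e pos))
                                     (subst T (sym ep) _) (subst (T ∘ not) (sym ec) _) hist
  ... | false | true = exchange-step pos-inj (swap-exchanges e pos)
                                     (subst T (sym ec) _) (subst (T ∘ not) (sym ep) _) hist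
  ... | true | true = ≤-trans (≤-reflexive (swap-same-side e (trans ec (sym ep)) hist)) (m≤m+n _ _)
  ... | false | false = ≤-trans (≤-reflexive (swap-same-side e (trans ec (sym ep)) hist)) (m≤m+n _ _)

  swaps-step : ∀ (es : List (Edge n)) {pos} → Injective _≡_ _≡_ pos → ∀ hist →
    potential (swaps es pos) hist ≤ potential pos hist + (M + K) * count (crosses S) es
  swaps-step [] {pos} pos-inj hist = m≤m+n _ _
  swaps-step (e ∷ es) {pos} pos-inj hist = begin
    potential (swaps es (swap e pos)) hist
      ≤⟨ swaps-step es (swap-injective e pos-inj) hist ⟩
    potential (swap e pos) hist + (M + K) * count (crosses S) es
      ≤⟨ +-monoˡ-≤ _ (swap-step pos-inj e hist) ⟩
    potential pos hist + (M + K) * ⟦ crosses S e ⟧ + (M + K) * count (crosses S) es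
      ≡⟨ +-assoc (potential pos hist) _ _ ⟩
    potential pos hist + ((M + K) * ⟦ crosses S e ⟧ + (M + K) * count (crosses S) es)
      ≡⟨ cong (potential pos hist +_) (*-distribˡ-+ (M + K) ⟦ crosses S e ⟧ _) ⟨
    potential pos hist + (M + K) * count (crosses S) (e ∷ es) ∎
    where open ≤-Reasoning

  level-bound-from : ∀ {pos} → Injective _≡_ _≡_ pos → ∀ hist σ alg → length alg ≡ length σ →
    sum (map (λ r → M ⊓ (r ∸ K)) (ranksFrom hist σ)) ≤ potential pos hist + (M + K) * levelCost S pos σ alg
  level-bound-from pos-inj hist [] alg _ = z≤n
  level-bound-from {pos} pos-inj hist (y ∷ σ) (es ∷ alg) len = begin
    gain + sum (map (λ r → M ⊓ (r ∸ K)) (ranksFrom (y ∷ hist) σ))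
      ≤⟨ +-monoʳ-≤ gain (level-bound-from pos₁-inj (y ∷ hist) σ alg (suc-injective len)) ⟩
    gain + (potential pos₁ (y ∷ hist) + m * rest)
      ≡⟨ regroup₁ gain (potential pos₁ (y ∷ hist)) (m * rest) ⟩
    potential pos₁ (y ∷ hist) + gain + m * rest
      ≤⟨ +-monoˡ-≤ (m * rest) (request-step pos₁-inj y hist) ⟩
    potential pos₁ hist + m * served + m * rest
      ≤⟨ +-monoˡ-≤ (m * rest) (+-monoˡ-≤ (m * served) (swaps-step es pos-inj hist)) ⟩
    potential pos hist + m * crossings + m * served + m * rest
      ≡⟨ regroup₂ (potential pos hist) m crossings served rest ⟩
    potential pos hist + m * (crossings + served + rest) ∎
    where
    open ≤-Reasoning
    m = M + K
    pos₁ = swaps es pos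
    pos₁-inj = swaps-injective es pos-inj
    gain = M ⊓ (rank y hist ∸ K)
    crossings = count (crosses S) es
    served = ⟦ outside pos₁ y ⟧
    rest = levelCost S pos₁ σ alg
    regroup₁ : ∀ a b c → a + (b + c) ≡ b + a + c
    regroup₁ = solve-∀
    regroup₂ : ∀ p m a b c → p + m * a + m * b + m * c ≡ p + m * (a + b + c)
    regroup₂ = solve-∀

  level-bound : ∀ {pos} → Injective _≡_ _≡_ pos → ∀ σ alg → length alg ≡ length σ →
    sum (map (λ r → M ⊓ (r ∸ K)) (ranks σ)) ≤ (M + K) * levelCost S pos σ alg
  level-bound {pos} pos-inj σ alg len =
    subst (λ Φ → _ ≤ Φ + (M + K) * levelCost S pos σ alg) (potential-[] pos)
          (level-bound-from pos-inj [] σ alg len)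

-- Combining the levels

count[2K≤rank]≤2*levelCost : ∀ (S : Fin n → Bool) {K} .{{_ : NonZero K}} → count S (allFin n) ≤ K →
  ∀ {pos} → Injective _≡_ _≡_ pos → ∀ σ alg → length alg ≡ length σ →
  count (λ r → 2 * K ≤ᵇ r) (ranks σ) ≤ 2 * levelCost S pos σ alg
count[2K≤rank]≤2*levelCost S {K} |S|≤K {pos} pos-inj σ alg len = *-cancelˡ-≤ K (begin
  K * count (λ r → 2 * K ≤ᵇ r) (ranks σ)            ≡⟨ sum-map-*ˡ K (λ r → ⟦ 2 * K ≤ᵇ r ⟧) (ranks σ) ⟨
  sum (map (λ r → K * ⟦ 2 * K ≤ᵇ r ⟧) (ranks σ))    ≤⟨ sum-map-mono frequent≤gain (ranks σ) ⟩
  sum (map (λ r → K ⊓ (r ∸ K)) (ranks σ))          ≤⟨ Potential.level-bound S |S|≤K K pos-inj σ alg len ⟩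
  (K + K) * levelCost S pos σ alg                   ≡⟨ double K (levelCost S pos σ alg) ⟩
  K * (2 * levelCost S pos σ alg)                   ∎)
  where
  open ≤-Reasoning
  double : ∀ k c → (k + k) * c ≡ k * (2 * c)
  double = solve-∀
  frequent≤gain : ∀ r → K * ⟦ 2 * K ≤ᵇ r ⟧ ≤ K ⊓ (r ∸ K)
  frequent≤gain r with 2 * K ≤ᵇ r in frequent
  ... | true = begin
    K * 1          ≡⟨ *-identityʳ K ⟩
    K              ≡⟨ m≤n⇒m⊓n≡m (m+n≤o⇒m≤o∸n K K+K≤r) ⟨
    K ⊓ (r ∸ K)    ∎
    where
    K+K≤r : K + K ≤ r
    K+K≤r = subst (_≤ r) (cong (K +_) (+-identityʳ K)) (≤ᵇ⇒≤ (2 * K) r (subst T (sym frequent) _))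
  ... | false = ≤-trans (≤-reflexive (*-zeroʳ K)) z≤n

levelWeight : ℕ → ℕ → ℕ
levelWeight zero r = 3 ⊓ (r ∸ 1)
levelWeight (suc i) r = ⟦ 2 ^ (3 + i) ≤ᵇ r ⟧

sum-levelWeight≤4*levelCost : ∀ j {pos : Config n} → Injective _≡_ _≡_ pos → ∀ σ alg → length alg ≡ length σ →
  sum (map (levelWeight j) (ranks σ)) ≤ 4 * levelCost (top j) pos σ alg
sum-levelWeight≤4*levelCost {n} zero pos-inj σ alg len =
  Potential.level-bound (top 0) (count-top≤ {n} 0) 3 pos-inj σ alg len
sum-levelWeight≤4*levelCost {n} (suc i) {pos} pos-inj σ alg len =
  ≤-trans (count[2K≤rank]≤2*levelCost (top (suc i)) {{m^n≢0 2 (2 + i)}}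
             (≤-trans (count-top≤ {n} (suc i)) (m∸n≤m _ 1)) pos-inj σ alg len)
          (*-monoˡ-≤ (levelCost (top (suc i)) pos σ alg) {2} {4} (s≤s (s≤s z≤n)))

weight : ℕ → ℕ → ℕ
weight L r = sum (map (λ j → levelWeight j r) (downFrom L))

3+L≤weight : ∀ L r → 2 ^ (2 + L) ≤ r → 3 + L ≤ weight (suc L) r
3+L≤weight zero r 4≤r = ≤-reflexive (sym (trans (+-identityʳ _) (m≤n⇒m⊓n≡m (∸-monoˡ-≤ 1 4≤r))))
3+L≤weight (suc L) r 2^[3+L]≤r = begin
  1 + (3 + L)                              ≡⟨ cong (_+ (3 + L)) (T⇒⟦⟧≡1 (≤⇒≤ᵇ 2^[3+L]≤r)) ⟨
  ⟦ 2 ^ (3 + L) ≤ᵇ r ⟧ + (3 + L)           ≤⟨ +-monoʳ-≤ _ (3+L≤weight L r 2^[2+L]≤r) ⟩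
  ⟦ 2 ^ (3 + L) ≤ᵇ r ⟧ + weight (suc L) r  ∎
  where
  open ≤-Reasoning
  2^[2+L]≤r : 2 ^ (2 + L) ≤ r
  2^[2+L]≤r = ≤-trans (^-monoʳ-≤ 2 (n≤1+n (2 + L))) 2^[3+L]≤r

r≤2^weight : ∀ L r → r < 2 ^ (3 + L) → r ≤ 2 ^ weight (suc L) r
r≤2^weight zero 0 _ = z≤n
r≤2^weight zero 1 _ = ≤ᵇ⇒≤ 1 _ _
r≤2^weight zero 2 _ = ≤ᵇ⇒≤ 2 _ _
r≤2^weight zero 3 _ = ≤ᵇ⇒≤ 3 _ _
r≤2^weight zero 4 _ = ≤ᵇ⇒≤ 4 _ _
r≤2^weight zero 5 _ = ≤ᵇ⇒≤ 5 _ _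
r≤2^weight zero 6 _ = ≤ᵇ⇒≤ 6 _ _
r≤2^weight zero 7 _ = ≤ᵇ⇒≤ 7 _ _
r≤2^weight zero (suc (suc (suc (suc (suc (suc (suc (suc r))))))))
  (s≤s (s≤s (s≤s (s≤s (s≤s (s≤s (s≤s (s≤s ()))))))))
r≤2^weight (suc L) r r<2^[4+L] with 2 ^ (3 + L) ≤? r
... | yes 2^[3+L]≤r = ≤-trans (<⇒≤ r<2^[4+L]) (^-monoʳ-≤ 2 (3+L≤weight (suc L) r 2^[3+L]≤r))
... | no 2^[3+L]≰r =
  ≤-trans (r≤2^weight L r (≰⇒> 2^[3+L]≰r)) (^-monoʳ-≤ 2 (m≤n+m (weight (suc L) r) (levelWeight (suc L) r)))

rank≤n : ∀ (y : Fin n) hist → rank y hist ≤ n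
rank≤n {n} y hist = begin
  rank y hist        ≤⟨ unique-⊆⇒length≤ (UniqueDec.deduplicate-! _≟_ (y ∷ since y hist)) (λ _ → ∈-allFin _) ⟩
  length (allFin n)  ≡⟨ length-tabulate id ⟩
  n                  ∎
  where open ≤-Reasoning

ranksFrom≤n : ∀ (hist σ : List (Fin n)) → All (_≤ n) (ranksFrom hist σ)
ranksFrom≤n hist [] = []
ranksFrom≤n hist (y ∷ σ) = rank≤n y hist ∷ ranksFrom≤n (y ∷ hist) σ

sum-weight≤4*cost : ∀ {pos : Config n} → Injective _≡_ _≡_ pos → ∀ L σ alg → length alg ≡ length σ →
  sum (map (weight L) (ranks σ)) ≤ 4 * cost pos σ alg
sum-weight≤4*cost {pos = pos} pos-inj L σ alg len = begin
  sum (map (weight L) (ranks σ))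
    ≡⟨ sum-map-comm (λ r j → levelWeight j r) (ranks σ) (downFrom L) ⟩
  sum (map (λ j → sum (map (levelWeight j) (ranks σ))) (downFrom L))
    ≤⟨ sum-map-mono (λ j → sum-levelWeight≤4*levelCost j pos-inj σ alg len) (downFrom L) ⟩
  sum (map (λ j → 4 * levelCost (top j) pos σ alg) (downFrom L))
    ≡⟨ sum-map-*ˡ 4 (λ j → levelCost (top j) pos σ alg) (downFrom L) ⟩
  4 * sum (map (λ j → levelCost (top j) pos σ alg) (downFrom L))
    ≤⟨ *-monoʳ-≤ 4 (levelCosts≤cost L pos σ alg) ⟩
  4 * cost pos σ alg ∎
  where open ≤-Reasoning

theorem1 : (n : ℕ) (σ : List (Fin n)) (pos₀ : Config n)
           → Injective _≡_ _≡_ pos₀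
           → (alg : List (List (Edge n))) → length alg ≡ length σ
           → twoToWS σ ≤ 2 ^ (4 * cost pos₀ σ alg)
theorem1 n σ pos₀ pos₀-inj alg len = begin
  twoToWS σ                                ≤⟨ product≤2^sum (All.map rank≤2^weight (ranksFrom≤n [] σ)) ⟩
  2 ^ sum (map (weight (suc n)) (ranks σ)) ≤⟨ ^-monoʳ-≤ 2 (sum-weight≤4*cost pos₀-inj (suc n) σ alg len) ⟩
  2 ^ (4 * cost pos₀ σ alg)                ∎
  where
  open ≤-Reasoning
  rank≤2^weight : ∀ {r} → r ≤ n → r ≤ 2 ^ weight (suc n) r
  rank≤2^weight r≤n = r≤2^weight n _ (≤-<-trans r≤n (<-≤-trans (n<2^n n) (^-monoʳ-≤ 2 (m≤n+m n 3))))
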